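{- (1) Let $B$ be a finite subset of $\mathrm{R}_1$. Then every temporal $B$-formula over $\{\mathsf{F},\mathsf{G},\mathsf{X},\mathsf{U},\mathsf{S}\}$ is satisfiable. (2) Let $B$ be a finite subset of $\mathrm{D}$. Then every temporal $B$-formula over $\{\mathsf{F},\mathsf{G},\mathsf{X},\mathsf{U},\mathsf{S}\}$ is satisfiable.
   Context: A Boolean function is a map $f:\{0,1\}^n\to\{0,1\}$; each is used as an $n$-ary propositional connective. $\mathrm{R}_1$ is the set of 1-reproducing Boolean functions ($f(1,\dots,1)=1$). $\mathrm{D}$ is the set of self-dual Boolean functions ($f(x_1,\dots,x_n)=\neg f(\neg x_1,\dots,\neg x_n)$ for all arguments). A temporal $B$-formula over a set $M$ of temporal operators is built from propositional variables using connectives from $B$ and operators from $M$. A structure $S=(s,V,\xi)$ is an infinite sequence $(s_i)_{i\in\mathbb N}$ of distinct states, a variable set $V$, and $\xi$ assigning to each state the set of variables true there. Semantics: $S,s_i\models x$ iff $x\in\xi(s_i)$; Boolean connectives pointwise; $S,s_i\models\mathsf{X}\varphi$ iff $S,s_{i+1}\models\varphi$; $S,s_i\models\varphi_1\mathsf{U}\varphi_2$ iff some $k\ge i$ has $S,s_k\models\varphi_2$ and $S,s_j\models\varphi_1$ for all $i\le j<k$; $S,s_i\models\varphi_1\mathsf{S}\varphi_2$ iff some $k\le i$ has $S,s_k\models\varphi_2$ and $S,s_j\models\varphi_1$ for all $k<j\le i$; $\mathsf{F}\varphi=\mathrm{true}\,\mathsf{U}\,\varphi$, $\mathsf{G}\varphi=\neg\mathsf{F}\neg\varphi$.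 A formula is satisfiable if it holds at some state of some structure. -}

module Defs where

open import Data.Nat using (ℕ; _≤_; _<_)
open import Data.Bool using (Bool; true; false; not)
open import Data.Fin using (Fin)
open import Data.Vec using (Vec; replicate; map)
open import Data.List using (List; length; lookup)
open import Data.List.Relation.Unary.All using (All)
open import Data.Product using (Σ; ∃; _×_; proj₁; proj₂)
open import Data.Vec.Relation.Unary.All using () renaming (All to VAll)
open import Function.Bundles using (_⇔_)
open import Relation.Binary.PropositionalEquality using (_≡_)

BoolFun : Set
BoolFun = Σ ℕ λ n → (Vec Bool n → Bool)

arity : BoolFun → ℕ
arity = proj₁

app : (f : BoolFun) → Vec Bool (arity f) → Bool
app = proj₂

R₁ : BoolFun → Set
R₁ f = app f (replicate (arity f) true) ≡ true

D : BoolFun → Set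
D f = ∀ (xs : Vec Bool (arity f)) → app f xs ≡ not (app f (map not xs))

data Formula (B : List BoolFun) : Set where
  var : ℕ → Formula B
  con : (k : Fin (length B)) → (Fin (arity (lookup B k)) → Formula B) → Formula B
  𝐅 : Formula B → Formula B
  𝐆 : Formula B → Formula B
  𝐗 : Formula B → Formula B
  _𝐔_ : Formula B → Formula B → Formula B
  _𝐒_ : Formula B → Formula B → Formula B

-- A structure: states s₀, s₁, … (pairwise distinct, identified with their
-- indices), variable set ℕ, and ξ i x = true iff x ∈ ξ(sᵢ).
record Structure : Set where
  field
    ξ : ℕ → ℕ → Bool
open Structure public

_,_⊨_ : {B : List BoolFun} → Structure → ℕ → Formula B → Set
S , i ⊨ var x = ξ S i x ≡ true
_,_⊨_ {B} S i (con k φs) =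
  Σ (Vec Bool (arity (lookup B k))) λ bs →
    (∀ j → (S , i ⊨ φs j) ⇔ (Data.Vec.lookup bs j ≡ true))
    × app (lookup B k) bs ≡ true
S , i ⊨ 𝐅 φ = ∃ λ k → i ≤ k × S , k ⊨ φ
S , i ⊨ 𝐆 φ = ∀ k → i ≤ k → S , k ⊨ φ
S , i ⊨ 𝐗 φ = S , Data.Nat.suc i ⊨ φ
S , i ⊨ (φ 𝐔 ψ) = ∃ λ k → i ≤ k × S , k ⊨ ψ × (∀ j → i ≤ j → j < k → S , j ⊨ φ)
S , i ⊨ (φ 𝐒 ψ) = ∃ λ k → k ≤ i × S , k ⊨ ψ × (∀ j → k < j → j ≤ i → S , j ⊨ φ)

Satisfiable : {B : List BoolFun} → Formula B → Set
Satisfiable φ = ∃ λ (S : Structure) → ∃ λ i → S , i ⊨ φ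

-- In a structure where every variable has the same value b at every state, all
-- states agree on every formula, so F, G, X, U and S collapse to (the second)
-- argument and a formula is true iff its Boolean skeleton evaluates to true on
-- the constant input b. For 1-reproducing connectives the skeleton is 1 at b = 1.
-- For self-dual connectives the skeletal values at 0 and 1 are complementary, so
-- one of the two constant structures satisfies the formula.
module Submission where

open import Defs
open import Data.Bool using (Bool; true; false; not)
open import Data.Bool.Properties using (not-involutive)
open import Data.Empty using (⊥-elim)
open import Data.Fin using (Fin)
open import Data.List using (List; length; lookup)
open import Data.List.Membership.Propositional.Properties using (∈-lookup)
open import Data.List.Relation.Unary.All using (All)
import Data.List.Relation.Unary.All as All
open import Data.Nat using (suc)
open import Data.Nat.Properties using (≤-refl; ≤⇒≯; <⇒≱)
open import Data.Product using (_×_; _,_)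
open import Data.Vec using (Vec; tabulate; replicate; map)
import Data.Vec as Vec
open import Data.Vec.Properties
  using (tabulate-cong; tabulate∘lookup; lookup∘tabulate; tabulate-∘; tabulate-allFin; map-const; map-∘; map-cong; map-id)
open import Function using (const; _∘_)
open import Function.Bundles using (_⇔_; mk⇔; module Equivalence)
open import Function.Construct.Composition using (_⇔-∘_)
open import Function.Construct.Symmetry using (⇔-sym)
open import Relation.Binary.PropositionalEquality
open ≡-Reasoning

open Equivalence using (to; from)

constant : Bool → Structure
constant b = record { ξ = λ _ _ → b }

≡true-injective : {x y : Bool} → (x ≡ true ⇔ y ≡ true) → x ≡ y
≡true-injective {false} {false} x⇔y = refl
≡true-injective {false} {true}  x⇔y = from x⇔y refl
≡true-injective {true}  {false} x⇔y = sym (to x⇔y refl)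
≡true-injective {true}  {true}  x⇔y = refl

tabulate-const : ∀ n {A : Set} (a : A) → tabulate {n = n} (const a) ≡ replicate n a
tabulate-const n a = trans (tabulate-allFin (const a)) (map-const _ a)

map-not-involutive : ∀ {n} (xs : Vec Bool n) → map not (map not xs) ≡ xs
map-not-involutive xs = begin
  map not (map not xs) ≡⟨ map-∘ not not xs ⟨
  map (not ∘ not) xs   ≡⟨ map-cong not-involutive xs ⟩
  map (λ x → x) xs     ≡⟨ map-id xs ⟩
  xs                   ∎

module _ {B : List BoolFun} where

  connective : Fin (length B) → BoolFun
  connective = lookup B

  All-lookup : ∀ {P : BoolFun → Set} → All P B → (k : Fin (length B)) → P (connective k)
  All-lookup ps k = All.lookup ps (∈-lookup k)

  skeleton : Bool → Formula B → Bool
  skeleton b (var x)    = b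
  skeleton b (con k φs) = app (connective k) (tabulate (skeleton b ∘ φs))
  skeleton b (𝐅 φ)      = skeleton b φ
  skeleton b (𝐆 φ)      = skeleton b φ
  skeleton b (𝐗 φ)      = skeleton b φ
  skeleton b (φ 𝐔 ψ)    = skeleton b ψ
  skeleton b (φ 𝐒 ψ)    = skeleton b ψ

  constant-⊨⇔ : ∀ b (φ : Formula B) i → (constant b , i ⊨ φ) ⇔ (skeleton b φ ≡ true)
  constant-⊨⇔ b (var x)    i = mk⇔ (λ v → v) (λ v → v)
  constant-⊨⇔ b (con k φs) i = mk⇔ connective-true witness
    where
    f = connective k
    values = tabulate (skeleton b ∘ φs)

    connective-true : constant b , i ⊨ con k φs → app f values ≡ true
    connective-true (bs , φs⇔bs , f-bs) = subst (λ v → app f v ≡ true) bs≡values f-bs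
      where
      bs≡values : bs ≡ values
      bs≡values = begin
        bs                                   ≡⟨ tabulate∘lookup bs ⟨
        tabulate (Vec.lookup bs)             ≡⟨ tabulate-cong (λ j →
          ≡true-injective (constant-⊨⇔ b (φs j) i ⇔-∘ ⇔-sym (φs⇔bs j))) ⟩
        values                               ∎

    witness : app f values ≡ true → constant b , i ⊨ con k φs
    witness f-values = values , values-correct , f-values
      where
      values-correct : ∀ j → (constant b , i ⊨ φs j) ⇔ (Vec.lookup values j ≡ true)
      values-correct j rewrite lookup∘tabulate (skeleton b ∘ φs) j = constant-⊨⇔ b (φs j) i
  constant-⊨⇔ b (𝐅 φ) i = mk⇔
    (λ (k , _ , φ-k) → to (constant-⊨⇔ b φ k) φ-k)
    (λ φ-true → i , ≤-refl , from (constant-⊨⇔ b φ i) φ-true)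
  constant-⊨⇔ b (𝐆 φ) i = mk⇔
    (λ φ-always → to (constant-⊨⇔ b φ i) (φ-always i ≤-refl))
    (λ φ-true k _ → from (constant-⊨⇔ b φ k) φ-true)
  constant-⊨⇔ b (𝐗 φ) i = constant-⊨⇔ b φ (suc i)
  constant-⊨⇔ b (φ 𝐔 ψ) i = mk⇔
    (λ (k , _ , ψ-k , _) → to (constant-⊨⇔ b ψ k) ψ-k)
    (λ ψ-true → i , ≤-refl , from (constant-⊨⇔ b ψ i) ψ-true ,
                λ j i≤j j<i → ⊥-elim (≤⇒≯ i≤j j<i))
  constant-⊨⇔ b (φ 𝐒 ψ) i = mk⇔
    (λ (k , _ , ψ-k , _) → to (constant-⊨⇔ b ψ k) ψ-k)
    (λ ψ-true → i , ≤-refl , from (constant-⊨⇔ b ψ i) ψ-true ,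
                λ j i<j j≤i → ⊥-elim (<⇒≱ i<j j≤i))

  constant-satisfiable : ∀ b (φ : Formula B) → skeleton b φ ≡ true → Satisfiable φ
  constant-satisfiable b φ φ-true = constant b , 0 , from (constant-⊨⇔ b φ 0) φ-true

  skeleton-R₁ : All R₁ B → (φ : Formula B) → skeleton true φ ≡ true
  skeleton-R₁ rs (var x)    = refl
  skeleton-R₁ rs (con k φs) = begin
    app f (tabulate (skeleton true ∘ φs)) ≡⟨ cong (app f) (tabulate-cong (skeleton-R₁ rs ∘ φs)) ⟩
    app f (tabulate (const true))         ≡⟨ cong (app f) (tabulate-const (arity f) true) ⟩
    app f (replicate (arity f) true)      ≡⟨ All-lookup rs k ⟩
    true                                  ∎
    where f = connective k
  skeleton-R₁ rs (𝐅 φ)   = skeleton-R₁ rs φ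
  skeleton-R₁ rs (𝐆 φ)   = skeleton-R₁ rs φ
  skeleton-R₁ rs (𝐗 φ)   = skeleton-R₁ rs φ
  skeleton-R₁ rs (φ 𝐔 ψ) = skeleton-R₁ rs ψ
  skeleton-R₁ rs (φ 𝐒 ψ) = skeleton-R₁ rs ψ

  skeleton-D : All D B → ∀ b (φ : Formula B) → skeleton (not b) φ ≡ not (skeleton b φ)
  skeleton-D ds b (var x)    = refl
  skeleton-D ds b (con k φs) = begin
    app f (tabulate (skeleton (not b) ∘ φs)) ≡⟨ cong (app f) (tabulate-cong (skeleton-D ds b ∘ φs)) ⟩
    app f (tabulate (not ∘ skeleton b ∘ φs)) ≡⟨ cong (app f) (tabulate-∘ not (skeleton b ∘ φs)) ⟩
    app f (map not values)                   ≡⟨ All-lookup ds k (map not values) ⟩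
    not (app f (map not (map not values)))   ≡⟨ cong (not ∘ app f) (map-not-involutive values) ⟩
    not (app f values)                       ∎
    where
    f = connective k
    values = tabulate (skeleton b ∘ φs)
  skeleton-D ds b (𝐅 φ)   = skeleton-D ds b φ
  skeleton-D ds b (𝐆 φ)   = skeleton-D ds b φ
  skeleton-D ds b (𝐗 φ)   = skeleton-D ds b φ
  skeleton-D ds b (φ 𝐔 ψ) = skeleton-D ds b ψ
  skeleton-D ds b (φ 𝐒 ψ) = skeleton-D ds b ψ

  R₁-satisfiable : All R₁ B → (φ : Formula B) → Satisfiable φ
  R₁-satisfiable rs φ = constant-satisfiable true φ (skeleton-R₁ rs φ)

  D-satisfiable : All D B → (φ : Formula B) → Satisfiable φ
  D-satisfiable ds φ with skeleton true φ in φ-at-true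
  ... | true  = constant-satisfiable true φ φ-at-true
  ... | false = constant-satisfiable false φ (trans (skeleton-D ds true φ) (cong not φ-at-true))

theorem3p5 : ((B : List BoolFun) → All R₁ B → (φ : Formula B) → Satisfiable φ)
    × ((B : List BoolFun) → All D B → (φ : Formula B) → Satisfiable φ)
theorem3p5 = (λ _ → R₁-satisfiable) , (λ _ → D-satisfiable)
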